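{- The moon is an idempotent modulo $\mathbb{Im}^\infty$: $\{\infty\,|\,\overline{\infty}\}+\{\infty\,|\,\overline{\infty}\}=_{\mathbb{Im}^\infty}\{\infty\,|\,\overline{\infty}\}$.
   Context: Affine normal play forms are built from terminating games $\infty$ (Left wins) and $\overline{\infty}$ (Right wins), absorbing under disjunctive sum. $\mathbb{Im}^\infty$ is the class of affine impartial forms (symmetric forms whose quiet followers are all symmetric, symmetry meaning Right options are the conjugates of the Left options). $G=_{\mathbb{Im}^\infty}H$ means $o(G+X)=o(H+X)$ for all $X\in\mathbb{Im}^\infty$. The moon is the form $\{\infty\,|\,\overline{\infty}\}$. -}

module Defs where

open import Data.Empty using (⊥)
open import Data.Bool using (Bool; true; false; not; _∨_)
open import Data.Product using (_×_; _,_)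
open import Data.List using (List; []; _∷_; _++_; map)
open import Data.List.Relation.Unary.All using (All)
open import Data.List.Membership.Propositional using (_∈_)
open import Relation.Binary.PropositionalEquality using (_≡_)

-- Affine normal play forms: the two terminating games ∞ (Left has won),
-- ∞̄ (Right has won), and ordinary forms { L | R } given by finite lists
-- of Left and Right options (which may themselves be ∞ or ∞̄).
data Form : Set where
  ∞    : Form
  ∞̄    : Form
  ⟨_∣_⟩ : List Form → List Form → Form

mutual
  conj : Form → Form
  conj ∞ = ∞̄
  conj ∞̄ = ∞
  conj ⟨ L ∣ R ⟩ = ⟨ conjs R ∣ conjs L ⟩

  conjs : List Form → List Form
  conjs [] = []
  conjs (g ∷ gs) = conj g ∷ conjs gs

-- Disjunctive sum; ∞ and ∞̄ are absorbing.
-- (The sum ∞ + ∞̄ never arises in play; by convention the left summand wins.)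
mutual
  _+_ : Form → Form → Form
  ∞ + _ = ∞
  ∞̄ + _ = ∞̄
  ⟨ GL ∣ GR ⟩ + ∞ = ∞
  ⟨ GL ∣ GR ⟩ + ∞̄ = ∞̄
  ⟨ GL ∣ GR ⟩ + ⟨ HL ∣ HR ⟩ =
    ⟨ sumL GL ⟨ HL ∣ HR ⟩ ++ sumR GL GR HL
    ∣ sumL GR ⟨ HL ∣ HR ⟩ ++ sumR GL GR HR ⟩

  sumL : List Form → Form → List Form
  sumL [] H = []
  sumL (g ∷ gs) H = (g + H) ∷ sumL gs H

  sumR : List Form → List Form → List Form → List Form
  sumR GL GR [] = []
  sumR GL GR (h ∷ hs) = (⟨ GL ∣ GR ⟩ + h) ∷ sumR GL GR hs

mutual
  leftFirst : Form → Bool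
  leftFirst ∞ = true
  leftFirst ∞̄ = false
  leftFirst ⟨ L ∣ R ⟩ = anyL L

  rightFirst : Form → Bool
  rightFirst ∞ = false
  rightFirst ∞̄ = true
  rightFirst ⟨ L ∣ R ⟩ = anyR R

  anyL : List Form → Bool
  anyL [] = false
  anyL (g ∷ gs) = not (rightFirst g) ∨ anyL gs

  anyR : List Form → Bool
  anyR [] = false
  anyR (g ∷ gs) = not (leftFirst g) ∨ anyR gs

-- Outcome o(G), encoded as (Left wins moving first, Right wins moving first):
-- (true,false)=L, (true,true)=N, (false,false)=P, (false,true)=R.
outcome : Form → Bool × Bool
outcome G = leftFirst G , rightFirst G

Symmetric : Form → Set
Symmetric ∞ = ⊥
Symmetric ∞̄ = ⊥
Symmetric ⟨ L ∣ R ⟩ = (∀ x → x ∈ R → x ∈ map conj L) × (∀ x → x ∈ map conj L → x ∈ R)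

-- Affine impartial forms 𝕀𝕞^∞: symmetric forms all of whose quiet
-- (i.e. non-terminating) followers are symmetric.
mutual
  data Impartial : Form → Set where
    imp : ∀ {L R} → Symmetric ⟨ L ∣ R ⟩ →
          All QuietOK L → All QuietOK R → Impartial ⟨ L ∣ R ⟩

  data QuietOK : Form → Set where
    term∞  : QuietOK ∞
    term∞̄  : QuietOK ∞̄
    quiet  : ∀ {L R} → Impartial ⟨ L ∣ R ⟩ → QuietOK ⟨ L ∣ R ⟩

_≡Im∞_ : Form → Form → Set
G ≡Im∞ H = ∀ X → Impartial X → outcome (G + X) ≡ outcome (H + X)

moon : Form
moon = ⟨ ∞ ∷ [] ∣ ∞̄ ∷ [] ⟩

{-# OPTIONS --safe #-}
module Submission where

open import Data.Bool using (true)
open import Data.List using ([]; _∷_)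
open import Data.Product using (_,_)
open import Relation.Binary.PropositionalEquality using (_≡_; refl; cong; sym; module ≡-Reasoning)

open import Defs

-- Moving first against any quiet form, each player wins at once by
-- playing to their terminating option in the first component.
outcome-terminal-options+quiet : ∀ L R XL XR →
  outcome (⟨ ∞ ∷ L ∣ ∞̄ ∷ R ⟩ + ⟨ XL ∣ XR ⟩) ≡ (true , true)
outcome-terminal-options+quiet L R XL XR = refl

moon+moon≡ : moon + moon ≡ ⟨ ∞ ∷ ∞ ∷ [] ∣ ∞̄ ∷ ∞̄ ∷ [] ⟩
moon+moon≡ = refl

corollary3p23 : (moon + moon) ≡Im∞ moon
corollary3p23 .(⟨ XL ∣ XR ⟩) (imp {XL} {XR} _ _ _) = begin
  outcome ((moon + moon) + X)                ≡⟨ cong (λ G → outcome (G + X)) moon+moon≡ ⟩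
  outcome (⟨ ∞ ∷ ∞ ∷ [] ∣ ∞̄ ∷ ∞̄ ∷ [] ⟩ + X)  ≡⟨ outcome-terminal-options+quiet (∞ ∷ []) (∞̄ ∷ []) XL XR ⟩
  (true , true)                              ≡⟨ sym (outcome-terminal-options+quiet [] [] XL XR) ⟩
  outcome (moon + X)                         ∎
  where
  open ≡-Reasoning
  X : Form
  X = ⟨ XL ∣ XR ⟩
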